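{- Let $m_1,m_2$ be positive integers and let $M=\{(x_1,y_1),\dots,(x_k,y_k)\}$ be an alignment of a string of $m_1$ letters with a string of $m_2$ letters. Then the conventional representation of $M$ has no alternate skips if and only if $M$, viewed as a subset of $[m_1]\times[m_2]$, is a maximal strict chain.
   Context: $[m]=\{1,\dots,m\}$. An alignment is a set $M=\{(x_1,y_1),\dots,(x_k,y_k)\}\subseteq[m_1]\times[m_2]$ ($k\ge0$) with $x_1<\dots<x_k$ and $y_1<\dots<y_k$ (the matched pairs of letters). The conventional representation of $M$: set $x_0=y_0=0$, $x_{k+1}=m_1+1$, $y_{k+1}=m_2+1$; for $j=0,\dots,k$, one writes first one column per unmatched letter $x_j+1,\dots,x_{j+1}-1$ of the first string (letter on top, skip "$-$" below), then one column per unmatched letter $y_j+1,\dots,y_{j+1}-1$ of the second string (skip on top, letter below), then (if $j<k$) the column of the matched pair $(x_{j+1},y_{j+1})$. It has alternate skips if a column with a first-string letter above a skip is immediately followed by a column with a skip above a second-string letter. A strict chain in $[m_1]\times[m_2]$ is a subset any two distinct elements $(a,b),(c,d)$ of which satisfy either $a>c$ and $b>d$, or $a<c$ and $b<d$; it is maximal if it is not properly contained in another strict chain. -}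

module Defs where

open import Level using (Level; suc; zero)
open import Data.Nat using (ℕ; _+_; _∸_; _≤_; _<_)
import Data.Nat as N
open import Data.Product using (_×_; _,_; proj₁; proj₂; ∃; ∃-syntax; Σ)
open import Data.Sum using (_⊎_)
open import Data.List using (List; []; _∷_; _++_; map; upTo)
open import Data.List.Relation.Unary.All using (All)
open import Data.List.Relation.Unary.Linked using (Linked)
open import Data.List.Membership.Propositional using (_∈_)
open import Relation.Binary.PropositionalEquality using (_≡_; _≢_)
open import Relation.Nullary using (¬_)

Point : Set
Point = ℕ × ℕ

InGrid : ℕ → ℕ → Point → Set
InGrid m₁ m₂ (a , b) = (1 ≤ a × a ≤ m₁) × (1 ≤ b × b ≤ m₂)

_≺_ : Point → Point → Set
(a , b) ≺ (c , d) = a < c × b < d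

-- An alignment M = {(x₁,y₁),…,(x_k,y_k)} is given as the list [(x₁,y₁),…,(x_k,y_k)]
-- with x₁<…<x_k, y₁<…<y_k, all pairs in [m₁]×[m₂].
IsAlignment : ℕ → ℕ → List Point → Set
IsAlignment m₁ m₂ M = All (InGrid m₁ m₂) M × Linked _≺_ M

data Column : Set where
  top   : ℕ → Column        -- letter of first string above a skip
  bot   : ℕ → Column        -- skip above a letter of the second string
  match : ℕ → ℕ → Column

-- the list a+1, …, b-1
between : ℕ → ℕ → List ℕ
between a b = map (λ i → a + N.suc i) (upTo (b ∸ a ∸ 1))

-- representation starting after the matched pair (x_j , y_j)
repFrom : ℕ → ℕ → ℕ → ℕ → List Point → List Column
repFrom m₁ m₂ x y [] =
  map top (between x (N.suc m₁)) ++ map bot (between y (N.suc m₂))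
repFrom m₁ m₂ x y ((x′ , y′) ∷ rest) =
  map top (between x x′) ++ map bot (between y y′)
    ++ (match x′ y′ ∷ repFrom m₁ m₂ x′ y′ rest)

conventionalRep : ℕ → ℕ → List Point → List Column
conventionalRep m₁ m₂ M = repFrom m₁ m₂ 0 0 M

HasAlternateSkips : List Column → Set
HasAlternateSkips cs =
  ∃[ pre ] ∃[ post ] ∃[ a ] ∃[ b ] cs ≡ pre ++ (top a ∷ bot b ∷ post)

SubsetP : Set₁
SubsetP = Point → Set

_⊆_ : SubsetP → SubsetP → Set
S ⊆ T = ∀ p → S p → T p

_⊂_ : SubsetP → SubsetP → Set
S ⊂ T = S ⊆ T × ∃[ p ] (T p × ¬ S p)

SubsetOfGrid : ℕ → ℕ → SubsetP → Set
SubsetOfGrid m₁ m₂ S = ∀ p → S p → InGrid m₁ m₂ p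

IsStrictChain : SubsetP → Set
IsStrictChain S = ∀ p q → S p → S q → p ≢ q → (q ≺ p) ⊎ (p ≺ q)

IsMaximalStrictChain : ℕ → ℕ → SubsetP → Set₁
IsMaximalStrictChain m₁ m₂ S =
  SubsetOfGrid m₁ m₂ S × IsStrictChain S ×
  ¬ (∃[ T ] (SubsetOfGrid m₁ m₂ T × IsStrictChain T × S ⊂ T))

asSubset : List Point → SubsetP
asSubset M p = p ∈ M

-- Add the sentinels (0, 0) and (m₁ + 1, m₂ + 1) at the ends of the chain M. Between two
-- consecutive points (x, y) ≺ (x′, y′) the representation writes the unmatched letters
-- x + 1, …, x′ − 1 on top, then y + 1, …, y′ − 1 below, then a matched column, so an alternate
-- skip occurs exactly at a step with both runs nonempty, i.e. with (x + 1, y + 1) ≺ (x′, y′).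
-- Such a step is exactly a place where a grid point comparable to every pair of M can be
-- inserted, and such a point exists exactly when M is not a maximal strict chain.

module Submission where

open import Defs
open import Data.Nat using (ℕ; suc; _≤_; _<_; _∸_; s≤s; z≤n)
open import Data.Nat.Properties
  using (≤-<-trans; <-trans; <-irrefl; n<1+n; ≤-pred; ∸-+-assoc; +-comm; m∸n≢0⇒n<m; m>n⇒m∸n≢0)
open import Data.List using (List; []; _∷_; _++_; [_]; map; upTo; length)
open import Data.List.Properties using (length-map; length-upTo; ++-identityʳ)
open import Data.List.Relation.Unary.All as All using (All; []; _∷_)
open import Data.List.Relation.Unary.All.Properties using (++⁺; ++⁻ˡ; ++⁻ʳ)
open import Data.List.Relation.Unary.AllPairs using (AllPairs; []; _∷_)
import Data.List.Relation.Unary.AllPairs.Properties as AllPairs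
open import Data.List.Relation.Unary.Linked.Properties using (Linked⇒AllPairs)
open import Data.List.Relation.Unary.Any using (here; there)
open import Data.List.Membership.Propositional using (_∈_)
open import Data.Product using (_×_; _,_; proj₁; proj₂; ∃)
open import Data.Sum using (_⊎_; inj₁; inj₂; swap)
open import Data.Empty using (⊥; ⊥-elim)
open import Data.Unit using (⊤; tt)
open import Function using (_∘_)
open import Function.Bundles using (_⇔_; mk⇔; Equivalence)
open import Function.Construct.Symmetry using (⇔-sym)
import Function.Related.Propositional as Related
open import Function.Related.TypeIsomorphisms using (¬-cong-⇔)
open import Relation.Nullary using (¬_)
open import Relation.Binary.PropositionalEquality using (_≡_; _≢_; refl; sym; trans; cong; subst)

open Equivalence using (to; from)

data AltSkip : List Column → Set where
  here  : ∀ {a b cs} → AltSkip (top a ∷ bot b ∷ cs)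
  there : ∀ {c cs} → AltSkip cs → AltSkip (c ∷ cs)

altSkip-++⁺ʳ : ∀ xs {cs} → AltSkip cs → AltSkip (xs ++ cs)
altSkip-++⁺ʳ []       s = s
altSkip-++⁺ʳ (x ∷ xs) s = there (altSkip-++⁺ʳ xs s)

hasAlternateSkips⇔altSkip : ∀ {cs} → HasAlternateSkips cs ⇔ AltSkip cs
hasAlternateSkips⇔altSkip = mk⇔ (λ { (pre , _ , _ , _ , refl) → altSkip-++⁺ʳ pre here }) split
  where
  split : ∀ {cs} → AltSkip cs → HasAlternateSkips cs
  split here = [] , _ , _ , _ , refl
  split (there {c} s) with split s
  ... | pre , post , a , b , eq = c ∷ pre , post , a , b , cong (c ∷_) eq

altSkip-bots⁻ : ∀ bs {cs} → AltSkip (map bot bs ++ cs) → AltSkip cs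
altSkip-bots⁻ []       s         = s
altSkip-bots⁻ (_ ∷ bs) (there s) = altSkip-bots⁻ bs s

StartsWithBot : List Column → Set
StartsWithBot (bot _ ∷ _) = ⊤
StartsWithBot _           = ⊥

altSkip-segment⁻ : ∀ as bs {cs} → ¬ StartsWithBot cs →
  AltSkip (map top as ++ map bot bs ++ cs) → (as ≢ [] × bs ≢ []) ⊎ AltSkip cs
altSkip-segment⁻ []           bs      _    s         = inj₂ (altSkip-bots⁻ bs s)
altSkip-segment⁻ (_ ∷ [])     []      ¬bot here      = ⊥-elim (¬bot tt)
altSkip-segment⁻ (_ ∷ [])     []      _    (there s) = inj₂ s
altSkip-segment⁻ (_ ∷ [])     (_ ∷ _) _    _         = inj₁ ((λ ()) , (λ ()))
altSkip-segment⁻ (_ ∷ a ∷ as) bs      ¬bot (there s) with altSkip-segment⁻ (a ∷ as) bs ¬bot s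
... | inj₁ (_ , bs≢[]) = inj₁ ((λ ()) , bs≢[])
... | inj₂ s′          = inj₂ s′

altSkip-segment⁺ : ∀ as bs {cs} → as ≢ [] → bs ≢ [] → AltSkip (map top as ++ map bot bs ++ cs)
altSkip-segment⁺ []           _       as≢[] _     = ⊥-elim (as≢[] refl)
altSkip-segment⁺ (_ ∷ [])     []      _     bs≢[] = ⊥-elim (bs≢[] refl)
altSkip-segment⁺ (_ ∷ [])     (_ ∷ _) _     _     = here
altSkip-segment⁺ (_ ∷ a ∷ as) bs      _     bs≢[] = there (altSkip-segment⁺ (a ∷ as) bs (λ ()) bs≢[])

length-between : ∀ a b → length (between a b) ≡ b ∸ suc a
length-between a b = trans (length-map _ (upTo (b ∸ a ∸ 1)))
  (trans (length-upTo (b ∸ a ∸ 1)) (trans (∸-+-assoc b a 1) (cong (b ∸_) (+-comm a 1))))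

between≢[]⇔ : ∀ a b → between a b ≢ [] ⇔ suc a < b
between≢[]⇔ a b = mk⇔
  (λ ≢[] → m∸n≢0⇒n<m (≢[] ∘ length≡0⇒≡[] ∘ trans (length-between a b)))
  (λ a<b ≡[] → m>n⇒m∸n≢0 a<b (trans (sym (length-between a b)) (cong length ≡[])))
  where
  length≡0⇒≡[] : ∀ {xs : List ℕ} → length xs ≡ 0 → xs ≡ []
  length≡0⇒≡[] {[]} _ = refl

origin : Point
origin = 0 , 0

corner : ℕ → ℕ → Point
corner m₁ m₂ = suc m₁ , suc m₂

next : Point → Point
next (a , b) = suc a , suc b

-- There is a point strictly between p and q exactly when next p ≺ q.
Roomy : Point → Point → Set
Roomy p q = next p ≺ q

Comparable : Point → Point → Set
Comparable p q = (q ≺ p) ⊎ (p ≺ q)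

≺-trans : ∀ {p q r} → p ≺ q → q ≺ r → p ≺ r
≺-trans (a<c , b<d) (c<e , d<f) = <-trans a<c c<e , <-trans b<d d<f

≺-next : ∀ p → p ≺ next p
≺-next (a , b) = n<1+n a , n<1+n b

≺-≺⇒roomy : ∀ {p q r} → p ≺ q → q ≺ r → Roomy p r
≺-≺⇒roomy (a<c , b<d) (c<e , d<f) = ≤-<-trans a<c c<e , ≤-<-trans b<d d<f

comparable-irrefl : ∀ {p} → ¬ Comparable p p
comparable-irrefl (inj₁ (a<a , _)) = <-irrefl refl a<a
comparable-irrefl (inj₂ (a<a , _)) = <-irrefl refl a<a

inGrid⇔ : ∀ {m₁ m₂ p} → InGrid m₁ m₂ p ⇔ (origin ≺ p × p ≺ corner m₁ m₂)
inGrid⇔ {p = a , b} = mk⇔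
  (λ ((0<a , a≤m₁) , (0<b , b≤m₂)) → (0<a , 0<b) , (s≤s a≤m₁ , s≤s b≤m₂))
  (λ ((0<a , 0<b) , (a<m₁ , b<m₂)) → (0<a , ≤-pred a<m₁) , (0<b , ≤-pred b<m₂))

data AnyAdjacent {A : Set} (R : A → A → Set) : List A → Set where
  here  : ∀ {x y xs} → R x y → AnyAdjacent R (x ∷ y ∷ xs)
  there : ∀ {x xs} → AnyAdjacent R xs → AnyAdjacent R (x ∷ xs)

module _ (m₁ m₂ : ℕ) where

  private
    closeLastSegment : ∀ as bs → map top as ++ map bot bs ≡ map top as ++ map bot bs ++ []
    closeLastSegment as bs = cong (map top as ++_) (sym (++-identityʳ (map bot bs)))

  altSkip⇒roomy : ∀ x y L → AltSkip (repFrom m₁ m₂ x y L) →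
    AnyAdjacent Roomy ((x , y) ∷ L ++ [ corner m₁ m₂ ])
  altSkip⇒roomy x y [] s
    with altSkip-segment⁻ (between x (suc m₁)) (between y (suc m₂)) {[]} (λ ())
           (subst AltSkip (closeLastSegment (between x (suc m₁)) (between y (suc m₂))) s)
  ... | inj₁ (≢[]₁ , ≢[]₂) = here (to (between≢[]⇔ x _) ≢[]₁ , to (between≢[]⇔ y _) ≢[]₂)
  ... | inj₂ ()
  altSkip⇒roomy x y ((x′ , y′) ∷ L) s with altSkip-segment⁻ (between x x′) (between y y′) (λ ()) s
  ... | inj₁ (≢[]₁ , ≢[]₂) = here (to (between≢[]⇔ x x′) ≢[]₁ , to (between≢[]⇔ y y′) ≢[]₂)
  ... | inj₂ (there s′)    = there (altSkip⇒roomy x′ y′ L s′)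

  roomy⇒altSkip : ∀ x y L → AnyAdjacent Roomy ((x , y) ∷ L ++ [ corner m₁ m₂ ]) →
    AltSkip (repFrom m₁ m₂ x y L)
  roomy⇒altSkip x y [] (here (x<m₁ , y<m₂)) =
    subst AltSkip (sym (closeLastSegment (between x (suc m₁)) (between y (suc m₂))))
      (altSkip-segment⁺ _ _ (from (between≢[]⇔ x _) x<m₁) (from (between≢[]⇔ y _) y<m₂))
  roomy⇒altSkip x y [] (there (there ()))
  roomy⇒altSkip x y ((x′ , y′) ∷ L) (here (x<x′ , y<y′)) =
    altSkip-segment⁺ _ _ (from (between≢[]⇔ x x′) x<x′) (from (between≢[]⇔ y y′) y<y′)
  roomy⇒altSkip x y ((x′ , y′) ∷ L) (there r) =
    altSkip-++⁺ʳ (map top (between x x′)) (altSkip-++⁺ʳ (map bot (between y y′))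
      (there (roomy⇒altSkip x′ y′ L r)))

  altSkip⇔roomy : ∀ x y L →
    AltSkip (repFrom m₁ m₂ x y L) ⇔ AnyAdjacent Roomy ((x , y) ∷ L ++ [ corner m₁ m₂ ])
  altSkip⇔roomy x y L = mk⇔ (altSkip⇒roomy x y L) (roomy⇒altSkip x y L)

Insertable : Point → Point → List Point → Point → Set
Insertable q e L p = q ≺ p × p ≺ e × All (Comparable p) L

roomy⇒insertable : ∀ {q e} L → AllPairs _≺_ (q ∷ L ++ [ e ]) →
  AnyAdjacent Roomy (q ∷ L ++ [ e ]) → ∃ (Insertable q e L)
roomy⇒insertable {q} [] _ (here r) = next q , ≺-next q , r , []
roomy⇒insertable [] _ (there (there ()))
roomy⇒insertable {q} (_ ∷ L) (_ ∷ r≺ ∷ _) (here r) =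
  next q , ≺-next q , ≺-trans r (All.head (++⁻ʳ L r≺)) ,
  inj₂ r ∷ All.map (inj₂ ∘ ≺-trans r) (++⁻ˡ L r≺)
roomy⇒insertable (_ ∷ L) (q≺ ∷ sorted) (there a) with roomy⇒insertable L sorted a
... | p , r≺p , p≺e , cmp = p , ≺-trans (All.head q≺) r≺p , p≺e , inj₁ r≺p ∷ cmp

insertable⇒roomy : ∀ {q e} L {p} → Insertable q e L p → AnyAdjacent Roomy (q ∷ L ++ [ e ])
insertable⇒roomy []      (q≺p , p≺e , [])              = here (≺-≺⇒roomy q≺p p≺e)
insertable⇒roomy (_ ∷ _) (q≺p , _   , inj₂ p≺r ∷ _)    = here (≺-≺⇒roomy q≺p p≺r)
insertable⇒roomy (_ ∷ L) (_   , p≺e , inj₁ r≺p ∷ cmp) = there (insertable⇒roomy L (r≺p , p≺e , cmp))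

roomy⇔insertable : ∀ {q e} L → AllPairs _≺_ (q ∷ L ++ [ e ]) →
  AnyAdjacent Roomy (q ∷ L ++ [ e ]) ⇔ ∃ (Insertable q e L)
roomy⇔insertable L sorted = mk⇔ (roomy⇒insertable L sorted) (λ (_ , ins) → insertable⇒roomy L ins)

alignment-sorted : ∀ {m₁ m₂ M} → IsAlignment m₁ m₂ M →
  AllPairs _≺_ (origin ∷ M ++ [ corner m₁ m₂ ])
alignment-sorted (grid , linked) =
  ++⁺ (All.map (proj₁ ∘ to inGrid⇔) grid) ((s≤s z≤n , s≤s z≤n) ∷ [])
  ∷ AllPairs.++⁺ (Linked⇒AllPairs ≺-trans linked) ([] ∷ [])
      (All.map (λ g → proj₂ (to inGrid⇔ g) ∷ []) grid)

allPairs⇒isStrictChain : ∀ {M} → AllPairs _≺_ M → IsStrictChain (asSubset M)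
allPairs⇒isStrictChain (_ ∷ _)      _ _ (here refl) (here refl) p≢q = ⊥-elim (p≢q refl)
allPairs⇒isStrictChain (≺xs ∷ _)    _ _ (here refl) (there q∈)  _   = inj₂ (All.lookup ≺xs q∈)
allPairs⇒isStrictChain (≺xs ∷ _)    _ _ (there p∈)  (here refl) _   = inj₁ (All.lookup ≺xs p∈)
allPairs⇒isStrictChain (_ ∷ sorted) p q (there p∈)  (there q∈)  p≢q =
  allPairs⇒isStrictChain sorted p q p∈ q∈ p≢q

∪-singleton-isStrictChain : ∀ {S p} → IsStrictChain S → (∀ q → S q → Comparable p q) →
  IsStrictChain (λ q → S q ⊎ q ≡ p)
∪-singleton-isStrictChain chain cmp u v (inj₁ u∈) (inj₁ v∈) u≢v = chain u v u∈ v∈ u≢v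
∪-singleton-isStrictChain chain cmp u _ (inj₁ u∈) (inj₂ refl) _ = swap (cmp u u∈)
∪-singleton-isStrictChain chain cmp _ v (inj₂ refl) (inj₁ v∈) _ = cmp v v∈
∪-singleton-isStrictChain chain cmp _ _ (inj₂ refl) (inj₂ refl) u≢v = ⊥-elim (u≢v refl)

isMaximalStrictChain⇔ : ∀ {m₁ m₂ M} → All (InGrid m₁ m₂) M → AllPairs _≺_ M →
  IsMaximalStrictChain m₁ m₂ (asSubset M) ⇔ (¬ ∃ (Insertable origin (corner m₁ m₂) M))
isMaximalStrictChain⇔ {m₁} {m₂} {M} grid sorted = mk⇔ noInsertable maximal
  where
  chain : IsStrictChain (asSubset M)
  chain = allPairs⇒isStrictChain sorted

  noInsertable : IsMaximalStrictChain m₁ m₂ (asSubset M) → ¬ ∃ (Insertable origin (corner m₁ m₂) M)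
  noInsertable (_ , _ , notExtensible) (p , o≺p , p≺c , cmp) = notExtensible
    ( (λ q → q ∈ M ⊎ q ≡ p) , extensionInGrid
    , ∪-singleton-isStrictChain chain (λ _ → All.lookup cmp)
    , (λ _ → inj₁) , p , inj₂ refl , comparable-irrefl ∘ All.lookup cmp )
    where
    extensionInGrid : SubsetOfGrid m₁ m₂ (λ q → q ∈ M ⊎ q ≡ p)
    extensionInGrid _ (inj₁ q∈) = All.lookup grid q∈
    extensionInGrid _ (inj₂ refl) = from inGrid⇔ (o≺p , p≺c)

  maximal : ¬ ∃ (Insertable origin (corner m₁ m₂) M) → IsMaximalStrictChain m₁ m₂ (asSubset M)
  maximal none = (λ _ → All.lookup grid) , chain ,
    λ (T , gridT , chainT , M⊆T , p , p∈T , p∉M) →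
      let o≺p , p≺c = to inGrid⇔ (gridT p p∈T) in
      none (p , o≺p , p≺c , All.tabulate (λ {q} q∈M →
        chainT p q p∈T (M⊆T q q∈M) (λ { refl → p∉M q∈M })))

proposition5 : (m₁ m₂ : ℕ) → 1 ≤ m₁ → 1 ≤ m₂ → (M : List Point) → IsAlignment m₁ m₂ M →
    (¬ HasAlternateSkips (conventionalRep m₁ m₂ M)) ⇔ IsMaximalStrictChain m₁ m₂ (asSubset M)
proposition5 m₁ m₂ _ _ M alignment@(grid , linked) = begin
  ¬ HasAlternateSkips (conventionalRep m₁ m₂ M)
    ∼⟨ ¬-cong-⇔ hasAlternateSkips⇔altSkip ⟩
  ¬ AltSkip (repFrom m₁ m₂ 0 0 M)
    ∼⟨ ¬-cong-⇔ (altSkip⇔roomy m₁ m₂ 0 0 M) ⟩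
  ¬ AnyAdjacent Roomy (origin ∷ M ++ [ corner m₁ m₂ ])
    ∼⟨ ¬-cong-⇔ (roomy⇔insertable M (alignment-sorted alignment)) ⟩
  ¬ ∃ (Insertable origin (corner m₁ m₂) M)
    ∼⟨ ⇔-sym (isMaximalStrictChain⇔ grid (Linked⇒AllPairs ≺-trans linked)) ⟩
  IsMaximalStrictChain m₁ m₂ (asSubset M)
    ∎
  where open Related.EquationalReasoning
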